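{- Let $G$ be a partial cube. Then $${\rm fdim}(G) = {\rm idim}(G) + p(X(G)) - 1.$$
   Context: All graphs are finite. For a string $u$, $u^{(i)}$ denotes its $i$-th coordinate. The $d$-cube $Q_d$ has vertex set $\{0,1\}^d$, two vertices adjacent iff they differ in exactly one coordinate. A Fibonacci string of length $d$ is a binary string of length $d$ with no two consecutive $1$s; the Fibonacci cube $\Gamma_d$ is the subgraph of $Q_d$ induced by the Fibonacci strings of length $d$. A graph $G$ isometrically embeds into $H$ if there is an injective map $V(G)\to V(H)$ preserving shortest-path distances. A partial cube is a graph that isometrically embeds into some hypercube. ${\rm idim}(G)$ is the least $k$ such that $G$ isometrically embeds into $Q_k$, and ${\rm fdim}(G)$ is the least $f$ such that $G$ isometrically embeds into $\Gamma_f$ (each is $\infty$ if no such integer exists). Semicubes and $X(G)$: let $G$ be a partial cube, $k={\rm idim}(G)$, and fix an isometric embedding $\beta:V(G)\to V(Q_k)$ (every coordinate $\beta^{(i)}$ then takes both values $0,1$ on $V(G)$; the resulting family of semicubes does not depend on the choice of $\beta$, up to reindexing). For $(i,\chi)\in[k]\times\{0,1\}$ the semicube is $W_{(i,\chi)}=\{u\in V(G)\mid \beta^{(i)}(u)=\chi\}$, and $W_{(i,0)},W_{(i,1)}$ form a complementary pair. $X(G)$ is the graph whose nodes are the $2k$ semicubes $W_{(i,\chi)}$, where $W_{(i,\chi)}$ and $W_{(j,\chi')}$ are adjacent iff $i\neq j$ and $W_{(i,\chi)}\cap W_{(j,\chi')}=\emptyset$. A coordinating path is a path $P$ of $X(G)$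 (a single node counts as a path) containing at most one node of each complementary pair $\{W_{(i,0)},W_{(i,1)}\}$. A system of coordinating paths is a set $\mathcal P$ of coordinating paths such that for each $i\in[k]$ there is exactly one $P\in\mathcal P$ containing a node of $\{W_{(i,0)},W_{(i,1)}\}$. $p(X(G))$ denotes the minimum size of a system of coordinating paths of $X(G)$. -}

module Defs where

open import Data.Nat using (ℕ; zero; suc; _≤_; _<_)
open import Data.Fin using (Fin)
open import Data.Bool using (Bool; true; false)
open import Data.Vec using (Vec; []; _∷_; lookup)
open import Data.List using (List; []; _∷_; length; map)
import Data.List
open import Data.List.Membership.Propositional using (_∈_)
open import Data.List.Relation.Unary.Unique.Propositional using (Unique)
open import Data.Product using (Σ; _×_; _,_; ∃; proj₁)
open import Data.Unit using (⊤)
open import Data.Empty using (⊥)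
open import Relation.Nullary using (¬_; Dec)
open import Relation.Binary.PropositionalEquality using (_≡_; _≢_)
open import Function.Definitions using (Injective)
open import Function.Bundles using (_⇔_)

record Graph : Set₁ where
  field
    V : Set
    E : V → V → Set
open Graph public

data Walk (H : Graph) : V H → V H → ℕ → Set where
  here : ∀ {u} → Walk H u u zero
  step : ∀ {u w v m} → E H u w → Walk H w v m → Walk H u v (suc m)

Dist : (H : Graph) → V H → V H → ℕ → Set
Dist H u v d = Walk H u v d × (∀ m → Walk H u v m → d ≤ m)

-- Isometric embedding: injective and preserves shortest-path distances
-- (in particular, distances are defined in G exactly when in H).
IsometricEmbedding : (G H : Graph) → (V G → V H) → Set
IsometricEmbedding G H f =
  Injective _≡_ _≡_ f × (∀ u v d → Dist G u v d ⇔ Dist H (f u) (f v) d)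

Embeds : Graph → Graph → Set
Embeds G H = Σ (V G → V H) (IsometricEmbedding G H)

record FinGraph (n : ℕ) : Set₁ where
  field
    adj     : Fin n → Fin n → Set
    adj?    : ∀ u v → Dec (adj u v)
    adj-sym : ∀ {u v} → adj u v → adj v u
    adj-irr : ∀ {u} → ¬ adj u u
open FinGraph public

toGraph : ∀ {n} → FinGraph n → Graph
toGraph {n} G = record { V = Fin n ; E = adj G }

DifferInExactlyOne : ∀ {d} → Vec Bool d → Vec Bool d → Set
DifferInExactlyOne {d} u v =
  ∃ λ (i : Fin d) → (lookup u i ≢ lookup v i) ×
                    (∀ j → j ≢ i → lookup u j ≡ lookup v j)

Q : ℕ → Graph
Q d = record { V = Vec Bool d ; E = DifferInExactlyOne }

-- No two consecutive 1s.
IsFib : ∀ {d} → Vec Bool d → Set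
IsFib [] = ⊤
IsFib (_ ∷ []) = ⊤
IsFib (true ∷ true ∷ _) = ⊥
IsFib (true ∷ false ∷ xs) = IsFib (false ∷ xs)
IsFib (false ∷ xs) = IsFib xs

FibString : ℕ → Set
FibString d = Σ (Vec Bool d) IsFib

Γ : ℕ → Graph
Γ d = record { V = FibString d
             ; E = λ u v → DifferInExactlyOne (proj₁ u) (proj₁ v) }

PartialCube : ∀ {n} → FinGraph n → Set
PartialCube G = ∃ λ k → Embeds (toGraph G) (Q k)

IsIdim : ∀ {n} → FinGraph n → ℕ → Set
IsIdim G k = Embeds (toGraph G) (Q k) × (∀ m → m < k → ¬ Embeds (toGraph G) (Q m))

IsFdim : ∀ {n} → FinGraph n → ℕ → Set
IsFdim G f = Embeds (toGraph G) (Γ f) × (∀ m → m < f → ¬ Embeds (toGraph G) (Γ m))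

-- Semicubes and X(G), relative to an isometric embedding β into Q_k.
-- Node (i , χ) of X(G) stands for the semicube W_(i,χ).

Node : ℕ → Set
Node k = Fin k × Bool

InSemicube : ∀ {n k} → (Fin n → Vec Bool k) → Node k → Fin n → Set
InSemicube β (i , χ) u = lookup (β u) i ≡ χ

XAdj : ∀ {n k} → (Fin n → Vec Bool k) → Node k → Node k → Set
XAdj β (i , χ) (j , χ') =
  (i ≢ j) × (∀ u → ¬ (InSemicube β (i , χ) u × InSemicube β (j , χ') u))

ConsecAdj : ∀ {n k} → (Fin n → Vec Bool k) → List (Node k) → Set
ConsecAdj β [] = ⊤
ConsecAdj β (_ ∷ []) = ⊤
ConsecAdj β (x ∷ y ∷ xs) = XAdj β x y × ConsecAdj β (y ∷ xs)

-- A coordinating path: a nonempty path of X(G) (listed in order) with at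
-- most one node of each complementary pair, i.e. the coordinate indices of
-- its nodes are pairwise distinct (which also makes its nodes distinct).
CoordinatingPath : ∀ {n k} → (Fin n → Vec Bool k) → List (Node k) → Set
CoordinatingPath β P =
  (P ≢ []) × ConsecAdj β P × Unique (map proj₁ P)

MeetsPair : ∀ {k} → List (Node k) → Fin k → Set
MeetsPair P i = ∃ λ χ → (i , χ) ∈ P

SystemOfCoordinatingPaths : ∀ {n k} → (Fin n → Vec Bool k) → List (List (Node k)) → Set
SystemOfCoordinatingPaths {k = k} β 𝒫 =
  (∀ (a : Fin (length 𝒫)) → CoordinatingPath β (Data.List.lookup 𝒫 a)) ×
  (∀ (i : Fin k) →
     (∃ λ (a : Fin (length 𝒫)) → MeetsPair (Data.List.lookup 𝒫 a) i) ×
     (∀ (a b : Fin (length 𝒫)) → MeetsPair (Data.List.lookup 𝒫 a) i →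
                                MeetsPair (Data.List.lookup 𝒫 b) i → a ≡ b))

IsPX : ∀ {n k} → (Fin n → Vec Bool k) → ℕ → Set
IsPX β p =
  (∃ λ 𝒫 → SystemOfCoordinatingPaths β 𝒫 × length 𝒫 ≡ p) ×
  (∀ 𝒫 → SystemOfCoordinatingPaths β 𝒫 → p ≤ length 𝒫)

module Submission where

-- Q_d and Γ_d are Hamming graphs: distance is the Hamming distance of the
-- strings naming the vertices, because two strings are joined by a walk of
-- that length each of whose vertices lies below one of the ends (and lowering
-- 1s keeps a string Fibonacci).  So a map of G into Γ_m is isometric as soon
-- as it reproduces the Hamming distances of β.  Both bounds pass through
-- layouts: lists of nodes of X(G) and blanks using every complementary pair
-- once, in which consecutive nodes are adjacent in X(G).  Reading a layout as
-- semicube indicators sends G isometrically into Γ of its length; conversely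
-- a list of nodes all of whose images are Fibonacci strings is chained.
-- Upper bound: joining the p paths of a system with p - 1 blanks gives a
-- layout of length k + p - 1.  Lower bound: given α : G → Γ_m, minimality of
-- k makes every coordinate i of β cut some edge of G; on that edge α changes
-- a coordinate j, and comparing distances to the two ends shows that j is the
-- indicator of a semicube of the pair of i.  Placing these nodes at their
-- positions in [m] gives a layout of length m, whose maximal runs form a
-- system of at most m - k + 1 coordinating paths.

open import Defs
open import Algebra.Properties.CommutativeSemigroup using (x∙yz≈y∙xz)
open import Data.Bool using (Bool; true; false)
import Data.Bool.Properties as Boolₚ
open import Data.Empty using (⊥-elim)
open import Data.Fin using (Fin; zero; suc)
import Data.Fin.Properties as Finₚ
open import Data.List using (List; []; _∷_; _++_; map; concat; length; catMaybes; allFin; tabulate)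
import Data.List as List
open import Data.List.Membership.Propositional using (_∈_)
open import Data.List.Membership.Propositional.Properties
  using (∈-allFin; ∈-map⁺; ∈-map⁻; ∈-++⁺ˡ; ∈-++⁺ʳ; ∈-++⁻; ∈-lookup)
open import Data.List.Membership.Propositional.Properties.WithK using (unique∧set⇒bag)
open import Data.List.Properties using (map-++; catMaybes-++; ++-identityʳ; map-tabulate; length-tabulate; length-map)
open import Data.List.Relation.Binary.BagAndSetEquality using (∼bag⇒↭)
open import Data.List.Relation.Binary.Disjoint.Propositional using (Disjoint)
open import Data.List.Relation.Binary.Permutation.Propositional using (_↭_)
open import Data.List.Relation.Binary.Permutation.Propositional.Properties using (map⁺; ↭-length)
open import Data.List.Relation.Unary.All as All using (All; []; _∷_)
import Data.List.Relation.Unary.All.Properties as Allₚ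
open import Data.List.Relation.Unary.AllPairs using ([]; _∷_)
open import Data.List.Relation.Unary.Any using (here; there)
open import Data.List.Relation.Unary.Unique.Propositional using (Unique)
import Data.List.Relation.Unary.Unique.Propositional.Properties as Uniqueₚ
open import Data.Maybe using (Maybe; just; nothing)
open import Data.Nat using (ℕ; zero; suc; _+_; _∸_; _≤_; _<_; z≤n; s≤s)
open import Data.Nat.ListAction using (sum)
open import Data.Nat.ListAction.Properties using (sum-↭)
open import Data.Nat.Properties
open import Data.Product using (Σ; _×_; _,_; ∃; proj₁; proj₂)
open import Data.Sum using (_⊎_; inj₁; inj₂)
open import Data.Unit using (⊤; tt)
open import Data.Vec using (Vec; []; _∷_; lookup; removeAt; toList; fromList)
import Data.Vec as Vec
open import Data.Vec.Properties
  using (tabulate∘lookup; tabulate-cong; toList∘fromList; length-toList; lookup-map; lookup∘tabulate)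
open import Function.Base using (id)
open import Function.Bundles using (_⇔_; mk⇔; Equivalence)
open import Function.Properties.Equivalence using () renaming (sym to ⇔-sym; trans to ⇔-trans)
open import Relation.Binary.PropositionalEquality
open import Relation.Nullary using (¬_; yes; no; ¬?)

open Equivalence using (to; from)

δ : Bool → Bool → ℕ
δ false false = 0
δ false true  = 1
δ true  false = 1
δ true  true  = 0

ham : ∀ {d} → Vec Bool d → Vec Bool d → ℕ
ham []       []       = 0
ham (a ∷ x) (b ∷ y) = δ a b + ham x y

δ-self : ∀ a → δ a a ≡ 0
δ-self false = refl
δ-self true  = refl

δ≤1 : ∀ a b → δ a b ≤ 1
δ≤1 false false = z≤n
δ≤1 false true  = s≤s z≤n
δ≤1 true  false = s≤s z≤n
δ≤1 true  true  = z≤n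

δ≡0⇒≡ : ∀ {a b} → δ a b ≡ 0 → a ≡ b
δ≡0⇒≡ {false} {false} _ = refl
δ≡0⇒≡ {true}  {true}  _ = refl

δ-differ : ∀ {a b} → a ≢ b → δ a b ≡ 1
δ-differ {false} {false} a≢b = ⊥-elim (a≢b refl)
δ-differ {false} {true}  _   = refl
δ-differ {true}  {false} _   = refl
δ-differ {true}  {true}  a≢b = ⊥-elim (a≢b refl)

lookup-ext : ∀ {d} {x y : Vec Bool d} → (∀ j → lookup x j ≡ lookup y j) → x ≡ y
lookup-ext {x = x} {y} eq =
  trans (sym (tabulate∘lookup x)) (trans (tabulate-cong eq) (tabulate∘lookup y))

ham-self : ∀ {d} (x : Vec Bool d) → ham x x ≡ 0
ham-self []      = refl
ham-self (a ∷ x) rewrite δ-self a = ham-self x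

ham≡0⇒≡ : ∀ {d} {x y : Vec Bool d} → ham x y ≡ 0 → x ≡ y
ham≡0⇒≡ {x = []}    {[]}    _ = refl
ham≡0⇒≡ {x = a ∷ x} {b ∷ y} h =
  cong₂ _∷_ (δ≡0⇒≡ (m+n≡0⇒m≡0 (δ a b) h)) (ham≡0⇒≡ (m+n≡0⇒n≡0 (δ a b) h))

ham-removeAt : ∀ {d} (x y : Vec Bool (suc d)) c →
  ham x y ≡ δ (lookup x c) (lookup y c) + ham (removeAt x c) (removeAt y c)
ham-removeAt (a ∷ x)      (b ∷ y)      zero    = refl
ham-removeAt (a ∷ a' ∷ x) (b ∷ b' ∷ y) (suc c) =
  trans (cong (δ a b +_) (ham-removeAt (a' ∷ x) (b' ∷ y) c))
        (x∙yz≈y∙xz +-commutativeSemigroup (δ a b) (δ (lookup (a' ∷ x) c) (lookup (b' ∷ y) c)) _)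

removeAt-agree : ∀ {d} (x y : Vec Bool (suc d)) c →
  (∀ j → j ≢ c → lookup x j ≡ lookup y j) → removeAt x c ≡ removeAt y c
removeAt-agree (a ∷ x) (b ∷ y) zero agree =
  lookup-ext (λ j → agree (suc j) (λ ()))
removeAt-agree (a ∷ a' ∷ x) (b ∷ b' ∷ y) (suc c) agree =
  cong₂ _∷_ (agree zero (λ ()))
            (removeAt-agree (a' ∷ x) (b' ∷ y) c
              (λ j j≢c → agree (suc j) (λ e → j≢c (Finₚ.suc-injective e))))

differ⇒ham≡1 : ∀ {d} {x y : Vec Bool d} → DifferInExactlyOne x y → ham x y ≡ 1
differ⇒ham≡1 {suc d} {x} {y} (c , x≢y , agree) = begin
  ham x y                                     ≡⟨ ham-removeAt x y c ⟩
  δ (lookup x c) (lookup y c) + ham x′ y′     ≡⟨ cong₂ _+_ (δ-differ x≢y) (cong (ham x′) y′≡x′) ⟩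
  1 + ham x′ x′                               ≡⟨ cong suc (ham-self x′) ⟩
  1                                           ∎
  where
  open ≡-Reasoning
  x′ y′ : Vec Bool d
  x′ = removeAt x c
  y′ = removeAt y c
  y′≡x′ : y′ ≡ x′
  y′≡x′ = sym (removeAt-agree x y c agree)

ham≡1⇒differ : ∀ {d} {x y : Vec Bool d} → ham x y ≡ 1 → DifferInExactlyOne x y
ham≡1⇒differ {x = []}    {[]}    ()
ham≡1⇒differ {x = a ∷ x} {b ∷ y} h with a Boolₚ.≟ b
... | no a≢b = zero , a≢b , agree
  where
  x≡y : x ≡ y
  x≡y = ham≡0⇒≡ (suc-injective (trans (cong (_+ ham x y) (sym (δ-differ a≢b))) h))
  agree : ∀ j → j ≢ zero → lookup (a ∷ x) j ≡ lookup (b ∷ y) j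
  agree zero    j≢0 = ⊥-elim (j≢0 refl)
  agree (suc j) _   = cong (λ v → lookup v j) x≡y
... | yes refl with ham≡1⇒differ {x = x} {y} (trans (cong (_+ ham x y) (sym (δ-self a))) h)
... | c , x≢y , agree = suc c , x≢y , agree′
  where
  agree′ : ∀ j → j ≢ suc c → lookup (a ∷ x) j ≡ lookup (a ∷ y) j
  agree′ zero    _     = refl
  agree′ (suc j) j≢sc = agree j (λ j≡c → j≢sc (cong suc j≡c))

ham-step : ∀ {d} (x w : Vec Bool d) → DifferInExactlyOne x w → ∀ y → ham x y ≤ suc (ham w y)
ham-step {suc d} x w (c , _ , agree) y = begin
  ham x y                                        ≡⟨ ham-removeAt x y c ⟩
  δ (lookup x c) (lookup y c) + ham x′ y′        ≤⟨ +-monoˡ-≤ (ham x′ y′) (δ≤1 _ _) ⟩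
  1 + ham x′ y′                                  ≡⟨ cong (λ v → 1 + ham v y′) (removeAt-agree x w c agree) ⟩
  1 + ham w′ y′                                  ≤⟨ s≤s (m≤n+m (ham w′ y′) _) ⟩
  suc (δ (lookup w c) (lookup y c) + ham w′ y′)  ≡⟨ cong suc (sym (ham-removeAt w y c)) ⟩
  suc (ham w y)                                  ∎
  where
  open ≤-Reasoning
  x′ y′ w′ : Vec Bool d
  x′ = removeAt x c
  y′ = removeAt y c
  w′ = removeAt w c

differ-elsewhere : ∀ {d} {x y : Vec Bool d} → DifferInExactlyOne x y → ∀ {c} → lookup x c ≢ lookup y c →
  ∀ j → j ≢ c → lookup x j ≡ lookup y j
differ-elsewhere (c′ , _ , agree) {c} cut j j≢c with c′ Finₚ.≟ c
... | yes refl = agree j j≢c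
... | no  c′≢c = ⊥-elim (cut (agree c (λ c≡c′ → c′≢c (sym c≡c′))))

closer-side : ∀ {d} {x y : Vec Bool d} → DifferInExactlyOne x y → ∀ {c} → lookup x c ≢ lookup y c →
  ∀ z → lookup z c ≡ lookup x c ⇔ ham z x < ham z y
closer-side {suc d} {x} {y} e {c} x≢y z
  rewrite ham-removeAt z x c | ham-removeAt z y c | removeAt-agree x y c (differ-elsewhere {x = x} {y} e x≢y) =
  side (lookup z c) (lookup x c) (lookup y c) x≢y (ham (removeAt z c) (removeAt y c))
  where
  side : ∀ a b b′ → b ≢ b′ → ∀ r → a ≡ b ⇔ δ a b + r < δ a b′ + r
  side false false true  _    r = mk⇔ (λ _ → ≤-refl) (λ _ → refl)
  side true  true  false _    r = mk⇔ (λ _ → ≤-refl) (λ _ → refl)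
  side false true  false _    r = mk⇔ (λ ()) (λ 1+r<r → ⊥-elim (<-irrefl refl (<-trans (n<1+n r) 1+r<r)))
  side true  false true  _    r = mk⇔ (λ ()) (λ 1+r<r → ⊥-elim (<-irrefl refl (<-trans (n<1+n r) 1+r<r)))
  side _     false false b≢b′ r = ⊥-elim (b≢b′ refl)
  side _     true  true  b≢b′ r = ⊥-elim (b≢b′ refl)

Below : ∀ {d} → Vec Bool d → Vec Bool d → Set
Below w x = ∀ j → lookup w j ≡ true → lookup x j ≡ true

Below-refl : ∀ {d} (x : Vec Bool d) → Below x x
Below-refl x j = id

Below-∷ : ∀ {d} {a b} {w x : Vec Bool d} → (a ≡ true → b ≡ true) → Below w x → Below (a ∷ w) (b ∷ x)
Below-∷ a≤b w≤x zero    = a≤b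
Below-∷ a≤b w≤x (suc j) = w≤x j

IsFib-tail : ∀ {d} a (x : Vec Bool d) → IsFib (a ∷ x) → IsFib x
IsFib-tail a     []          _ = tt
IsFib-tail false (b ∷ x)     f = f
IsFib-tail true  (false ∷ x) f = f

-- IsFib is a proposition, so a Fibonacci string is determined by its bits.
IsFib-irrelevant : ∀ {d} (x : Vec Bool d) (p q : IsFib x) → p ≡ q
IsFib-irrelevant []                  tt tt = refl
IsFib-irrelevant (_ ∷ [])            tt tt = refl
IsFib-irrelevant (true ∷ false ∷ x)  p  q  = IsFib-irrelevant (false ∷ x) p q
IsFib-irrelevant (false ∷ b ∷ x)     p  q  = IsFib-irrelevant (b ∷ x) p q

IsFib-downward : ∀ {d} (w x : Vec Bool d) → Below w x → IsFib x → IsFib w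
IsFib-downward []                     []                      _   _ = tt
IsFib-downward (_ ∷ [])               (_ ∷ [])                _   _ = tt
IsFib-downward (false ∷ b ∷ w)        (a ∷ a′ ∷ x)            w≤x f =
  IsFib-downward (b ∷ w) (a′ ∷ x) (λ j → w≤x (suc j)) (IsFib-tail a (a′ ∷ x) f)
IsFib-downward (true ∷ b ∷ w)         (false ∷ a′ ∷ x)        w≤x f with w≤x zero refl
... | ()
IsFib-downward (true ∷ true ∷ w)      (true ∷ true ∷ x)       _   ()
IsFib-downward (true ∷ true ∷ w)      (true ∷ false ∷ x)      w≤x f with w≤x (suc zero) refl
... | ()
IsFib-downward (true ∷ false ∷ [])    (true ∷ _ ∷ [])         _   _ = tt
IsFib-downward (true ∷ false ∷ c ∷ w) (true ∷ true ∷ x)       _   ()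
IsFib-downward (true ∷ false ∷ c ∷ w) (true ∷ false ∷ c′ ∷ x) w≤x f =
  IsFib-downward (c ∷ w) (c′ ∷ x) (λ j → w≤x (suc (suc j))) f

IsFib-∷∷ : ∀ {d} a b (x : Vec Bool d) → ¬ (a ≡ true × b ≡ true) → IsFib (b ∷ x) → IsFib (a ∷ b ∷ x)
IsFib-∷∷ false b     x _   f = f
IsFib-∷∷ true  false x _   f = f
IsFib-∷∷ true  true  x ¬11 _ = ¬11 (refl , refl)

IsFib-no-11 : ∀ {d} a b (x : Vec Bool d) → IsFib (a ∷ b ∷ x) → ¬ (a ≡ true × b ≡ true)
IsFib-no-11 true true x () (refl , refl)

data WalkWithin {d} (P : Vec Bool d → Set) : Vec Bool d → Vec Bool d → ℕ → Set where
  stay : ∀ {u} → P u → WalkWithin P u u zero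
  move : ∀ {u w v m} → P u → DifferInExactlyOne u w → WalkWithin P w v m → WalkWithin P u v (suc m)

walk-start : ∀ {d} {P : Vec Bool d → Set} {u v m} → WalkWithin P u v m → P u
walk-start (stay p)     = p
walk-start (move p _ _) = p

differ-∷ : ∀ {d} c {x y : Vec Bool d} → DifferInExactlyOne x y → DifferInExactlyOne (c ∷ x) (c ∷ y)
differ-∷ c (i , x≢y , agree) =
  suc i , x≢y , λ { zero _ → refl ; (suc j) j≢i → agree j (λ j≡i → j≢i (cong suc j≡i)) }

differ-head : ∀ {d} {a b} (x : Vec Bool d) → a ≢ b → DifferInExactlyOne (a ∷ x) (b ∷ x)
differ-head x a≢b = zero , a≢b , λ { zero j≢0 → ⊥-elim (j≢0 refl) ; (suc j) _ → refl }

prefix-walk : ∀ {d} (c : Bool) {P : Vec Bool d → Set} {R : Vec Bool (suc d) → Set} {u v m} →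
  (∀ {w} → P w → R (c ∷ w)) → WalkWithin P u v m → WalkWithin R (c ∷ u) (c ∷ v) m
prefix-walk c f (stay p)       = stay (f p)
prefix-walk c f (move p e wlk) = move (f p) (differ-∷ c e) (prefix-walk c f wlk)

extend-walk : ∀ {d} {P : Vec Bool d → Set} {u v w m} →
  WalkWithin P u v m → DifferInExactlyOne v w → P w → WalkWithin P u w (suc m)
extend-walk (stay p)        e pw = move p e (stay pw)
extend-walk (move p e′ wlk) e pw = move p e′ (extend-walk wlk e pw)

Between : ∀ {d} → Vec Bool d → Vec Bool d → Vec Bool d → Set
Between x y w = Below w x ⊎ Below w y

Between-∷ : ∀ {d} {a b b′} {x y w : Vec Bool d} →
  (a ≡ true → b ≡ true) → (a ≡ true → b′ ≡ true) → Between x y w → Between (b ∷ x) (b′ ∷ y) (a ∷ w)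
Between-∷ a≤b a≤b′ (inj₁ w≤x) = inj₁ (Below-∷ a≤b w≤x)
Between-∷ a≤b a≤b′ (inj₂ w≤y) = inj₂ (Below-∷ a≤b′ w≤y)

-- A geodesic from x to y: first lower the 1s of x that y lacks, then raise
-- those of y that x lacks, so that every vertex lies below x or below y.
geodesic : ∀ {d} (x y : Vec Bool d) → WalkWithin (Between x y) x y (ham x y)
geodesic []      []      = stay (inj₁ (Below-refl []))
geodesic (false ∷ x) (false ∷ y) = prefix-walk false (Between-∷ id id) (geodesic x y)
geodesic (true  ∷ x) (true  ∷ y) = prefix-walk true  (Between-∷ id id) (geodesic x y)
geodesic (true  ∷ x) (false ∷ y) =
  move (inj₁ (Below-refl (true ∷ x))) (differ-head x (λ ()))
       (prefix-walk false (Between-∷ (λ ()) (λ ())) (geodesic x y))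
geodesic (false ∷ x) (true  ∷ y) =
  extend-walk (prefix-walk false (Between-∷ (λ ()) (λ ())) (geodesic x y))
              (differ-head y (λ ())) (inj₂ (Below-refl (true ∷ y)))

record HammingGraph (H : Graph) (d : ℕ) : Set where
  field
    code      : V H → Vec Bool d
    dist-code : ∀ x y m → Dist H x y m ⇔ ham (code x) (code y) ≡ m
open HammingGraph

hamming-graph : ∀ {H : Graph} {d} (code : V H → Vec Bool d) →
  (∀ {x y} → E H x y → DifferInExactlyOne (code x) (code y)) →
  (∀ x y → Walk H x y (ham (code x) (code y))) → HammingGraph H d
hamming-graph {H} code edge-differ shortest = record
  { code = code
  ; dist-code = λ x y m → mk⇔
      (λ (wlk , minimal) → ≤-antisym (walk-bound wlk) (minimal _ (shortest x y)))
      (λ { refl → shortest x y , λ _ → walk-bound })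
  }
  where
  walk-bound : ∀ {x y m} → Walk H x y m → ham (code x) (code y) ≤ m
  walk-bound {x} here = ≤-reflexive (ham-self (code x))
  walk-bound {x} {y} (step {w = w} e wlk) =
    ≤-trans (ham-step (code x) (code w) (edge-differ e) (code y)) (s≤s (walk-bound wlk))

forget-within : ∀ {d} {P : Vec Bool d → Set} {u v m} → WalkWithin P u v m → Walk (Q d) u v m
forget-within (stay _)       = here
forget-within (move _ e wlk) = step e (forget-within wlk)

-- The hypercube is a Hamming graph, and so is the Fibonacci cube: the
-- geodesic between two Fibonacci strings stays among Fibonacci strings.
Q-hamming : ∀ d → HammingGraph (Q d) d
Q-hamming d = hamming-graph id id (λ x y → forget-within (geodesic x y))

walk-in-Γ : ∀ {d} {P : Vec Bool d → Set} {u v m} → (∀ {w} → P w → IsFib w) →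
  WalkWithin P u v m → (fu : IsFib u) (fv : IsFib v) → Walk (Γ d) (u , fu) (v , fv) m
walk-in-Γ {u = u} _ (stay _) fu fv rewrite IsFib-irrelevant u fu fv = here
walk-in-Γ fib (move _ e wlk) fu fv = step e (walk-in-Γ fib wlk (fib (walk-start wlk)) fv)

Γ-hamming : ∀ d → HammingGraph (Γ d) d
Γ-hamming d = hamming-graph proj₁ id
  (λ (x , fx) (y , fy) → walk-in-Γ (λ {w} → between-fib {x} {y} fx fy {w}) (geodesic x y) fx fy)
  where
  between-fib : ∀ {x y} → IsFib x → IsFib y → ∀ {w} → Between x y w → IsFib w
  between-fib {x} fx fy {w} (inj₁ w≤x) = IsFib-downward w x w≤x fx
  between-fib {y = y} fx fy {w} (inj₂ w≤y) = IsFib-downward w y w≤y fy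

module PartialCubeFacts {n k} (G : FinGraph n) (β : Fin n → Vec Bool k)
                        (isβ : IsometricEmbedding (toGraph G) (Q k) β) where

  dist-β : ∀ u v m → Dist (toGraph G) u v m ⇔ ham (β u) (β v) ≡ m
  dist-β u v m = ⇔-trans (proj₂ isβ u v m) (dist-code (Q-hamming k) (β u) (β v) m)

  isometric-via-ham : ∀ {H d} (h : HammingGraph H d) (f : Fin n → V H) →
    (∀ u v → ham (code h (f u)) (code h (f v)) ≡ ham (β u) (β v)) →
    IsometricEmbedding (toGraph G) H f
  isometric-via-ham h f same = injective , λ u v m →
    ⇔-trans (dist-β u v m) (⇔-trans (rewrite-ham u v m) (⇔-sym (dist-code h (f u) (f v) m)))
    where
    rewrite-ham : ∀ u v m → (ham (β u) (β v) ≡ m) ⇔ (ham (code h (f u)) (code h (f v)) ≡ m)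
    rewrite-ham u v m rewrite same u v = mk⇔ (λ e → e) (λ e → e)
    injective : ∀ {u v} → f u ≡ f v → u ≡ v
    injective {u} {v} fu≡fv = proj₁ isβ (ham≡0⇒≡ (begin
      ham (β u) (β v)                   ≡⟨ sym (same u v) ⟩
      ham (code h (f u)) (code h (f v)) ≡⟨ cong (λ w → ham (code h w) (code h (f v))) fu≡fv ⟩
      ham (code h (f v)) (code h (f v)) ≡⟨ ham-self (code h (f v)) ⟩
      0                                 ∎))
      where open ≡-Reasoning

  edge-differ : ∀ {u v} → adj G u v → DifferInExactlyOne (β u) (β v)
  edge-differ {u} {v} uv = ham≡1⇒differ {x = β u} {β v} (to (dist-β u v 1) (step uv here , at-least-one))
    where
    at-least-one : ∀ m → Walk (toGraph G) u v m → 1 ≤ m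
    at-least-one .zero here         = ⊥-elim (adj-irr G uv)
    at-least-one _     (step _ _)   = s≤s z≤n

  -- G is connected, so a two-valued function taking both values changes
  -- value along some edge.
  changes-along-edge : ∀ (g : Fin n → Bool) {u v} → g u ≢ g v →
    Σ (Fin n) λ x → Σ (Fin n) λ y → adj G x y × g x ≢ g y
  changes-along-edge g {u} {v} = along (proj₁ (from (dist-β u v _) refl))
    where
    along : ∀ {u v m} → Walk (toGraph G) u v m → g u ≢ g v →
      Σ (Fin n) λ x → Σ (Fin n) λ y → adj G x y × g x ≢ g y
    along here gu≢gv = ⊥-elim (gu≢gv refl)
    along {u} (step {w = w} uw wlk) gu≢gv with g u Boolₚ.≟ g w
    ... | yes gu≡gw = along wlk (λ gw≡gv → gu≢gv (trans gu≡gw gw≡gv))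
    ... | no  gu≢gw = u , w , uw , gu≢gw

delete-constant-coordinate : ∀ {n k} (G : FinGraph n) (β : Fin n → Vec Bool (suc k)) →
  IsometricEmbedding (toGraph G) (Q (suc k)) β → ∀ i →
  (∀ u v → lookup (β u) i ≡ lookup (β v) i) → Embeds (toGraph G) (Q k)
delete-constant-coordinate {n} {k} G β isβ i constant = β′ , isometric-via-ham (Q-hamming k) β′ same
  where
  open PartialCubeFacts G β isβ
  β′ : Fin n → Vec Bool k
  β′ u = removeAt (β u) i
  same : ∀ u v → ham (β′ u) (β′ v) ≡ ham (β u) (β v)
  same u v = sym (begin
    ham (β u) (β v)                      ≡⟨ ham-removeAt (β u) (β v) i ⟩
    δ (βᵢ u) (βᵢ v) + ham (β′ u) (β′ v)  ≡⟨ cong (λ b → δ b (βᵢ v) + ham (β′ u) (β′ v)) (constant u v) ⟩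
    δ (βᵢ v) (βᵢ v) + ham (β′ u) (β′ v)  ≡⟨ cong (_+ ham (β′ u) (β′ v)) (δ-self (βᵢ v)) ⟩
    ham (β′ u) (β′ v)                    ∎)
    where
    open ≡-Reasoning
    βᵢ : Fin n → Bool
    βᵢ u = lookup (β u) i

crossing-edge : ∀ {n k} (G : FinGraph n) (β : Fin n → Vec Bool k) →
  IsometricEmbedding (toGraph G) (Q k) β → (∀ m → m < k → ¬ Embeds (toGraph G) (Q m)) → ∀ i →
  Σ (Fin n) λ x → Σ (Fin n) λ y → adj G x y × lookup (β x) i ≢ lookup (β y) i
crossing-edge {k = suc k} G β isβ minimal i
  with Finₚ.any? (λ u → Finₚ.any? (λ v → ¬? (lookup (β u) i Boolₚ.≟ lookup (β v) i)))
... | yes (u , v , differ) = PartialCubeFacts.changes-along-edge G β isβ (λ w → lookup (β w) i) differ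
... | no none = ⊥-elim (minimal k ≤-refl (delete-constant-coordinate G β isβ i constant))
  where
  constant : ∀ u v → lookup (β u) i ≡ lookup (β v) i
  constant u v with lookup (β u) i Boolₚ.≟ lookup (β v) i
  ... | yes e = e
  ... | no ne = ⊥-elim (none (u , v , ne))

covering-permutation : ∀ {k} (xs : List (Fin k)) → Unique xs → (∀ i → i ∈ xs) → xs ↭ allFin k
covering-permutation {k} xs unique complete =
  ∼bag⇒↭ (unique∧set⇒bag unique (Uniqueₚ.allFin⁺ k)
                           (λ {i} → mk⇔ (λ _ → ∈-allFin i) (λ _ → complete i)))

blanks : ∀ {A : Set} → List (Maybe A) → ℕ
blanks []            = 0
blanks (nothing ∷ l) = suc (blanks l)
blanks (just _  ∷ l) = blanks l

length-blanks : ∀ {A : Set} (l : List (Maybe A)) → length l ≡ length (catMaybes l) + blanks l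
length-blanks []            = refl
length-blanks (nothing ∷ l) = trans (cong suc (length-blanks l)) (sym (+-suc _ _))
length-blanks (just _  ∷ l) = cong suc (length-blanks l)

agree : Bool → Bool → Bool
agree false false = true
agree false true  = false
agree true  false = false
agree true  true  = true

agree-true : ∀ a b → agree a b ≡ true ⇔ a ≡ b
agree-true false false = mk⇔ (λ _ → refl) (λ _ → refl)
agree-true false true  = mk⇔ (λ ()) (λ ())
agree-true true  false = mk⇔ (λ ()) (λ ())
agree-true true  true  = mk⇔ (λ _ → refl) (λ _ → refl)

-- agree a c as a function of a preserves δ (it is the identity or negation).
δ-agree : ∀ a b c → δ (agree a c) (agree b c) ≡ δ a b
δ-agree false false c     = δ-self (agree false c)
δ-agree true  true  c     = δ-self (agree true c)
δ-agree false true  false = refl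
δ-agree false true  true  = refl
δ-agree true  false false = refl
δ-agree true  false true  = refl

-- Layouts: a list of nodes of X(G) and blanks.  Read in order, a layout
-- assigns to each vertex u a binary string: a node (i, χ) contributes the
-- bit [u ∈ W_(i,χ)] and a blank contributes 0.
module Layout {n k} (β : Fin n → Vec Bool k) where

  bit : Fin n → Maybe (Node k) → Bool
  bit u nothing        = false
  bit u (just (i , χ)) = agree (lookup (β u) i) χ

  bit-true : ∀ u x → bit u (just x) ≡ true ⇔ InSemicube β x u
  bit-true u (i , χ) = agree-true (lookup (β u) i) χ

  image : ∀ {m} → Vec (Maybe (Node k)) m → Fin n → Vec Bool m
  image t u = Vec.map (bit u) t

  indices : List (Maybe (Node k)) → List (Fin k)
  indices l = map proj₁ (catMaybes l)

  Chained : List (Maybe (Node k)) → Set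
  Chained []                     = ⊤
  Chained (just x ∷ just y ∷ l) = XAdj β x y × Chained (just y ∷ l)
  Chained (_ ∷ l)                = Chained l

  record IsLayout (l : List (Maybe (Node k))) : Set where
    field
      unique   : Unique (indices l)
      complete : ∀ i → i ∈ indices l
      chained  : Chained l

  -- The nodes of a layout are indexed by a permutation of the coordinates.
  layout-length : ∀ {l} → IsLayout l → length l ≡ k + blanks l
  layout-length {l} L = trans (length-blanks l) (cong (_+ blanks l) (begin
    length (catMaybes l)  ≡⟨ sym (length-map proj₁ (catMaybes l)) ⟩
    length (indices l)    ≡⟨ ↭-length (covering-permutation (indices l) unique complete) ⟩
    length (allFin k)     ≡⟨ length-tabulate (λ i → i) ⟩
    k                     ∎))
    where
    open IsLayout L
    open ≡-Reasoning

  -- The image of a layout with each pair used exactly once reproduces the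
  -- Hamming distances of β: coordinate i of β reappears, possibly
  -- complemented, at the position of the node with index i.
  δ-at : Fin n → Fin n → Fin k → ℕ
  δ-at u v i = δ (lookup (β u) i) (lookup (β v) i)

  ham-image : ∀ {m} (t : Vec (Maybe (Node k)) m) u v →
    ham (image t u) (image t v) ≡ sum (map (δ-at u v) (indices (toList t)))
  ham-image []                 u v = refl
  ham-image (nothing ∷ t)      u v = ham-image t u v
  ham-image (just (i , χ) ∷ t) u v =
    cong₂ _+_ (δ-agree (lookup (β u) i) (lookup (β v) i) χ) (ham-image t u v)

  ham-as-sum : ∀ {d} (x y : Vec Bool d) → ham x y ≡ sum (tabulate (λ i → δ (lookup x i) (lookup y i)))
  ham-as-sum []      []      = refl
  ham-as-sum (a ∷ x) (b ∷ y) = cong (δ a b +_) (ham-as-sum x y)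

  image-ham : ∀ {m} (t : Vec (Maybe (Node k)) m) →
    Unique (indices (toList t)) → (∀ i → i ∈ indices (toList t)) →
    ∀ u v → ham (image t u) (image t v) ≡ ham (β u) (β v)
  image-ham t unique complete u v = begin
    ham (image t u) (image t v)                      ≡⟨ ham-image t u v ⟩
    sum (map (δ-at u v) (indices (toList t)))        ≡⟨ sum-↭ (map⁺ (δ-at u v) permutation) ⟩
    sum (map (δ-at u v) (allFin k))                  ≡⟨ cong sum (map-tabulate (λ i → i) (δ-at u v)) ⟩
    sum (tabulate (δ-at u v))                        ≡⟨ sym (ham-as-sum (β u) (β v)) ⟩
    ham (β u) (β v)                                  ∎
    where
    open ≡-Reasoning
    permutation : indices (toList t) ↭ allFin k
    permutation = covering-permutation (indices (toList t)) unique complete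

  Chained-tail : ∀ a l → Chained (a ∷ l) → Chained l
  Chained-tail nothing  l              c       = c
  Chained-tail (just x) []             _       = tt
  Chained-tail (just x) (nothing ∷ l)  c       = c
  Chained-tail (just x) (just y ∷ l)   (_ , c) = c

  unique-tail : ∀ a l → Unique (indices (a ∷ l)) → Unique (indices l)
  unique-tail nothing  l u       = u
  unique-tail (just x) l (_ ∷ u) = u

  -- Two consecutive entries of a chained layout are never both 1: their
  -- semicubes are disjoint.
  chained-no-11 : ∀ a b l → Chained (a ∷ b ∷ l) → ∀ u → ¬ (bit u a ≡ true × bit u b ≡ true)
  chained-no-11 nothing  b        l _             u (() , _)
  chained-no-11 (just x) nothing  l _             u (_ , ())
  chained-no-11 (just x) (just y) l ((_ , disj) , _) u (ux , uy) =
    disj u (to (bit-true u x) ux , to (bit-true u y) uy)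

  no-11-chained : ∀ a b l → (∀ u → ¬ (bit u a ≡ true × bit u b ≡ true)) →
    Unique (indices (a ∷ b ∷ l)) → Chained (b ∷ l) → Chained (a ∷ b ∷ l)
  no-11-chained nothing        b              l _     _ c = c
  no-11-chained (just x)       nothing        l _     _ c = c
  no-11-chained (just (i , χ)) (just (j , χ′)) l no-11 ((i≢j ∷ _) ∷ _) c =
    (i≢j , λ u (ui , uj) → no-11 u (from (bit-true u (i , χ)) ui , from (bit-true u (j , χ′)) uj)) , c

  chained⇒fib : ∀ {m} (t : Vec (Maybe (Node k)) m) → Chained (toList t) → ∀ u → IsFib (image t u)
  chained⇒fib []          _ u = tt
  chained⇒fib (a ∷ [])    _ u = tt
  chained⇒fib (a ∷ b ∷ t) c u =
    IsFib-∷∷ (bit u a) (bit u b) (image t u) (chained-no-11 a b (toList t) c u)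
             (chained⇒fib (b ∷ t) (Chained-tail a (b ∷ toList t) c) u)

  fib⇒chained : ∀ {m} (t : Vec (Maybe (Node k)) m) → Unique (indices (toList t)) →
    (∀ u → IsFib (image t u)) → Chained (toList t)
  fib⇒chained []             _      _   = tt
  fib⇒chained (nothing ∷ []) _      _   = tt
  fib⇒chained (just _ ∷ [])  _      _   = tt
  fib⇒chained (a ∷ b ∷ t)    unique fib =
    no-11-chained a b (toList t) (λ u → IsFib-no-11 (bit u a) (bit u b) (image t u) (fib u)) unique
      (fib⇒chained (b ∷ t) (unique-tail a (b ∷ toList t) unique)
                   (λ u → IsFib-tail (bit u a) (image (b ∷ t) u) (fib u)))

module _ {A : Set} where

  tabulate-∈ : ∀ {m} (g : Fin m → Maybe A) j {x} → g j ≡ just x → x ∈ catMaybes (toList (Vec.tabulate g))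
  tabulate-∈ g zero    gj≡x rewrite gj≡x = here refl
  tabulate-∈ g (suc j) gj≡x with g zero
  ... | nothing = tabulate-∈ (λ j → g (suc j)) j gj≡x
  ... | just _  = there (tabulate-∈ (λ j → g (suc j)) j gj≡x)

  tabulate-∈⁻ : ∀ {m} (g : Fin m → Maybe A) {x} → x ∈ catMaybes (toList (Vec.tabulate g)) →
    Σ (Fin m) λ j → g j ≡ just x
  tabulate-∈⁻ {suc m} g x∈ with g zero in g0≡
  ... | nothing = (λ (j , gj≡x) → suc j , gj≡x) (tabulate-∈⁻ (λ j → g (suc j)) x∈)
  ... | just y with x∈
  ...   | here refl = zero , g0≡
  ...   | there x∈′ = (λ (j , gj≡x) → suc j , gj≡x) (tabulate-∈⁻ (λ j → g (suc j)) x∈′)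

  tabulate-unique : ∀ {B : Set} {m} (g : Fin m → Maybe A) (key : A → B) →
    (∀ j j′ {x x′} → g j ≡ just x → g j′ ≡ just x′ → key x ≡ key x′ → j ≡ j′) →
    Unique (map key (catMaybes (toList (Vec.tabulate g))))
  tabulate-unique {m = zero}  g key injective = []
  tabulate-unique {m = suc m} g key injective =
    with-head (g zero) refl (tabulate-unique (λ j → g (suc j)) key
      (λ j j′ e e′ same → Finₚ.suc-injective (injective (suc j) (suc j′) e e′ same)))
    where
    rest : List A
    rest = catMaybes (toList (Vec.tabulate (λ j → g (suc j))))
    with-head : ∀ s → g zero ≡ s → Unique (map key rest) →
      Unique (map key (catMaybes (s ∷ toList (Vec.tabulate (λ j → g (suc j))))))
    with-head nothing  _   u = u
    with-head (just y) g0≡ u = All.tabulate fresh ∷ u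
      where
      fresh : ∀ {z} → z ∈ map key rest → key y ≢ z
      fresh z∈ key-y≡z with ∈-map⁻ key z∈
      ... | x , x∈ , refl with tabulate-∈⁻ (λ j → g (suc j)) x∈
      ...   | j , gj≡x = Finₚ.0≢1+n (injective zero (suc j) g0≡ gj≡x key-y≡z)

unique-++⁻ : ∀ {A : Set} (xs : List A) {ys} → Unique (xs ++ ys) → Unique xs × Unique ys × Disjoint xs ys
unique-++⁻ []       u       = [] , u , λ ()
unique-++⁻ (x ∷ xs) (x∉ ∷ u) with unique-++⁻ xs u
... | uxs , uys , disj =
  Allₚ.++⁻ˡ xs x∉ ∷ uxs , uys ,
  λ { (here refl , x∈ys) → All.lookup (Allₚ.++⁻ʳ xs x∉) x∈ys refl
    ; (there v∈xs , v∈ys) → disj (v∈xs , v∈ys) }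

all-at : ∀ {A : Set} {P : A → Set} {xs : List A} → All P xs → ∀ a → P (List.lookup xs a)
all-at pxs a = All.lookup pxs (∈-lookup a)

module _ {k : ℕ} where

  coords : List (Node k) → List (Fin k)
  coords = map proj₁

  meets⇔ : ∀ (P : List (Node k)) i → MeetsPair P i ⇔ i ∈ coords P
  meets⇔ P i = mk⇔ (λ (χ , iχ∈P) → ∈-map⁺ proj₁ iχ∈P) from′
    where
    from′ : i ∈ coords P → MeetsPair P i
    from′ i∈ with ∈-map⁻ proj₁ i∈
    ... | (.i , χ) , iχ∈P , refl = χ , iχ∈P

  meets-concat : ∀ (𝒫 : List (List (Node k))) i →
    (∃ λ a → MeetsPair (List.lookup 𝒫 a) i) ⇔ i ∈ coords (concat 𝒫)
  meets-concat 𝒫 i = mk⇔ (λ (a , meets) → to′ 𝒫 a (to (meets⇔ _ i) meets)) (from′ 𝒫)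
    where
    to′ : ∀ 𝒫 a → i ∈ coords (List.lookup 𝒫 a) → i ∈ coords (concat 𝒫)
    to′ (P ∷ 𝒫) zero    i∈ = subst (i ∈_) (sym (map-++ proj₁ P (concat 𝒫))) (∈-++⁺ˡ i∈)
    to′ (P ∷ 𝒫) (suc a) i∈ =
      subst (i ∈_) (sym (map-++ proj₁ P (concat 𝒫))) (∈-++⁺ʳ (coords P) (to′ 𝒫 a i∈))
    from′ : ∀ 𝒫 → i ∈ coords (concat 𝒫) → ∃ λ a → MeetsPair (List.lookup 𝒫 a) i
    from′ (P ∷ 𝒫) i∈ with ∈-++⁻ (coords P) (subst (i ∈_) (map-++ proj₁ P (concat 𝒫)) i∈)
    ... | inj₁ i∈P = zero , from (meets⇔ P i) i∈P
    ... | inj₂ i∈𝒫 with from′ 𝒫 i∈𝒫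
    ...   | a , meets = suc a , meets

  MetAtMostOnce : List (List (Node k)) → Set
  MetAtMostOnce 𝒫 = ∀ i a b → MeetsPair (List.lookup 𝒫 a) i → MeetsPair (List.lookup 𝒫 b) i → a ≡ b

  unique-concat : ∀ (𝒫 : List (List (Node k))) →
    Unique (coords (concat 𝒫)) ⇔ ((∀ a → Unique (coords (List.lookup 𝒫 a))) × MetAtMostOnce 𝒫)
  unique-concat 𝒫 = mk⇔ (to′ 𝒫) (λ (u , once) → from′ 𝒫 u once)
    where
    split : ∀ P 𝒫 → Unique (coords (concat (P ∷ 𝒫))) ⇔ Unique (coords P ++ coords (concat 𝒫))
    split P 𝒫 rewrite map-++ proj₁ P (concat 𝒫) = mk⇔ (λ u → u) (λ u → u)
    to′ : ∀ 𝒫 → Unique (coords (concat 𝒫)) →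
      (∀ a → Unique (coords (List.lookup 𝒫 a))) × MetAtMostOnce 𝒫
    to′ []      _ = (λ ()) , λ i ()
    to′ (P ∷ 𝒫) u with unique-++⁻ (coords P) (to (split P 𝒫) u)
    ... | uP , u𝒫 , disj = unique-at , once
      where
      rest : (∀ a → Unique (coords (List.lookup 𝒫 a))) × MetAtMostOnce 𝒫
      rest = to′ 𝒫 u𝒫
      unique-at : ∀ a → Unique (coords (List.lookup (P ∷ 𝒫) a))
      unique-at zero    = uP
      unique-at (suc a) = proj₁ rest a
      clash : ∀ {i} {A : Set} b → MeetsPair P i → MeetsPair (List.lookup 𝒫 b) i → A
      clash {i} b mP m𝒫 = ⊥-elim (disj (to (meets⇔ P i) mP , to (meets-concat 𝒫 i) (b , m𝒫)))
      once : MetAtMostOnce (P ∷ 𝒫)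
      once i zero    zero    _  _  = refl
      once i zero    (suc b) ma mb = clash b ma mb
      once i (suc a) zero    ma mb = clash a mb ma
      once i (suc a) (suc b) ma mb = cong suc (proj₂ rest i a b ma mb)
    from′ : ∀ 𝒫 → (∀ a → Unique (coords (List.lookup 𝒫 a))) → MetAtMostOnce 𝒫 →
      Unique (coords (concat 𝒫))
    from′ []      _ _    = []
    from′ (P ∷ 𝒫) u once = from (split P 𝒫) (Uniqueₚ.++⁺ (u zero)
      (from′ 𝒫 (λ a → u (suc a)) (λ i a b ma mb → Finₚ.suc-injective (once i (suc a) (suc b) ma mb)))
      λ {i} (i∈P , i∈𝒫) → let (b , mb) = from (meets-concat 𝒫 i) i∈𝒫 in
        Finₚ.0≢1+n (once i zero (suc b) (from (meets⇔ P i) i∈P) mb))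

join : ∀ {A : Set} → List (List A) → List (Maybe A)
join []           = []
join (P ∷ [])     = map just P
join (P ∷ Q ∷ 𝒫) = map just P ++ nothing ∷ join (Q ∷ 𝒫)

catMaybes-just : ∀ {A : Set} (P : List A) → catMaybes (map just P) ≡ P
catMaybes-just []      = refl
catMaybes-just (x ∷ P) = cong (x ∷_) (catMaybes-just P)

blanks-just : ∀ {A : Set} (P : List A) → blanks (map just P) ≡ 0
blanks-just []      = refl
blanks-just (x ∷ P) = blanks-just P

blanks-++ : ∀ {A : Set} (l l′ : List (Maybe A)) → blanks (l ++ l′) ≡ blanks l + blanks l′
blanks-++ []            l′ = refl
blanks-++ (nothing ∷ l) l′ = cong suc (blanks-++ l l′)
blanks-++ (just _  ∷ l) l′ = blanks-++ l l′

catMaybes-join : ∀ {A : Set} (𝒫 : List (List A)) → catMaybes (join 𝒫) ≡ concat 𝒫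
catMaybes-join []           = refl
catMaybes-join (P ∷ [])     = trans (catMaybes-just P) (sym (++-identityʳ P))
catMaybes-join (P ∷ Q ∷ 𝒫) = trans (catMaybes-++ (map just P) (nothing ∷ join (Q ∷ 𝒫)))
                                    (cong₂ _++_ (catMaybes-just P) (catMaybes-join (Q ∷ 𝒫)))

blanks-join : ∀ {A : Set} (𝒫 : List (List A)) → blanks (join 𝒫) ≡ length 𝒫 ∸ 1
blanks-join []           = refl
blanks-join (P ∷ [])     = blanks-just P
blanks-join (P ∷ Q ∷ 𝒫) = trans (blanks-++ (map just P) (nothing ∷ join (Q ∷ 𝒫)))
                                 (cong₂ (λ b b′ → b + suc b′) (blanks-just P) (blanks-join (Q ∷ 𝒫)))

join-length : ∀ {A : Set} k (𝒫 : List (List A)) → length (join 𝒫) ≡ k + blanks (join 𝒫) →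
  length (join 𝒫) ≡ k + length 𝒫 ∸ 1
join-length k []       len = cong (_∸ 1) len
join-length k (P ∷ 𝒫) len = begin
  length (join (P ∷ 𝒫))          ≡⟨ len ⟩
  k + blanks (join (P ∷ 𝒫))      ≡⟨ cong (k +_) (blanks-join (P ∷ 𝒫)) ⟩
  k + length 𝒫                    ≡⟨⟩
  suc (k + length 𝒫) ∸ 1          ≡⟨ cong (_∸ 1) (sym (+-suc k (length 𝒫))) ⟩
  k + suc (length 𝒫) ∸ 1          ∎
  where open ≡-Reasoning

-- Cut a list at its blanks into its maximal nonempty runs of nodes.
-- runs l = (the run before the first blank, the runs after it).
close : ∀ {A : Set} → List A × List (List A) → List (List A)
close ([]    , rs) = rs
close (x ∷ r , rs) = (x ∷ r) ∷ rs

runs : ∀ {A : Set} → List (Maybe A) → List A × List (List A)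
runs []            = [] , []
runs (nothing ∷ l) = [] , close (runs l)
runs (just x  ∷ l) = x ∷ proj₁ (runs l) , proj₂ (runs l)

groups : ∀ {A : Set} → List (Maybe A) → List (List A)
groups l = close (runs l)

concat-groups : ∀ {A : Set} (l : List (Maybe A)) → concat (groups l) ≡ catMaybes l
concat-groups l = trans (concat-close (runs l)) (concat-runs l)
  where
  concat-close : ∀ {A : Set} (p : List A × List (List A)) → concat (close p) ≡ proj₁ p ++ concat (proj₂ p)
  concat-close ([]    , rs) = refl
  concat-close (x ∷ r , rs) = refl
  concat-runs : ∀ {A : Set} (l : List (Maybe A)) → proj₁ (runs l) ++ concat (proj₂ (runs l)) ≡ catMaybes l
  concat-runs []            = refl
  concat-runs (nothing ∷ l) = concat-groups l
  concat-runs (just x  ∷ l) = cong (x ∷_) (concat-runs l)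

length-groups : ∀ {A : Set} (l : List (Maybe A)) → length (groups l) ≤ suc (blanks l)
length-groups l = ≤-trans (length-close (runs l)) (s≤s (length-runs l))
  where
  length-close : ∀ {A : Set} (p : List A × List (List A)) → length (close p) ≤ suc (length (proj₂ p))
  length-close ([]    , rs) = n≤1+n _
  length-close (x ∷ r , rs) = ≤-refl
  length-runs : ∀ {A : Set} (l : List (Maybe A)) → length (proj₂ (runs l)) ≤ blanks l
  length-runs []            = z≤n
  length-runs (nothing ∷ l) = length-groups l
  length-runs (just x  ∷ l) = length-runs l

All-close : ∀ {A : Set} {P : List A → Set} (p : List A × List (List A)) →
  (proj₁ p ≢ [] → P (proj₁ p)) → All P (proj₂ p) → All P (close p)
All-close ([]    , rs) _  prs = prs
All-close (x ∷ r , rs) pr prs = pr (λ ()) ∷ prs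

groups-nonempty : ∀ {A : Set} (l : List (Maybe A)) → All (λ P → P ≢ []) (groups l)
groups-nonempty l = All-close (runs l) (λ r≢[] → r≢[]) (runs-nonempty l)
  where
  runs-nonempty : ∀ {A : Set} (l : List (Maybe A)) → All (λ P → P ≢ []) (proj₂ (runs l))
  runs-nonempty []            = []
  runs-nonempty (nothing ∷ l) = groups-nonempty l
  runs-nonempty (just x  ∷ l) = runs-nonempty l

module SystemsAndLayouts {n k} (β : Fin n → Vec Bool k) where
  open Layout β

  -- A coordinating path, written as a list of nodes, is chained; so is a
  -- join of such paths, as blanks break the chain condition.
  chained-just : ∀ P → ConsecAdj β P → Chained (map just P)
  chained-just []          _         = tt
  chained-just (x ∷ [])    _         = tt
  chained-just (x ∷ y ∷ P) (xy , c)  = xy , chained-just (y ∷ P) c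

  chained-just-blank : ∀ P l → ConsecAdj β P → Chained l → Chained (map just P ++ nothing ∷ l)
  chained-just-blank []          l _        c = c
  chained-just-blank (x ∷ [])    l _        c = c
  chained-just-blank (x ∷ y ∷ P) l (xy , cP) c = xy , chained-just-blank (y ∷ P) l cP c

  chained-join : ∀ 𝒫 → (∀ a → ConsecAdj β (List.lookup 𝒫 a)) → Chained (join 𝒫)
  chained-join []           _ = tt
  chained-join (P ∷ [])     c = chained-just P (c zero)
  chained-join (P ∷ Q ∷ 𝒫) c =
    chained-just-blank P (join (Q ∷ 𝒫)) (c zero) (chained-join (Q ∷ 𝒫) (λ a → c (suc a)))

  groups-chained : ∀ l → Chained l → All (ConsecAdj β) (groups l)

  runs-chained : ∀ l → Chained l → ConsecAdj β (proj₁ (runs l)) × All (ConsecAdj β) (proj₂ (runs l))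
  runs-chained []                     _        = tt , []
  runs-chained (nothing ∷ l)          c        = tt , groups-chained l c
  runs-chained (just x ∷ [])          _        = tt , []
  runs-chained (just x ∷ nothing ∷ l) c        = tt , groups-chained l c
  runs-chained (just x ∷ just y ∷ l)  (xy , c) with runs-chained (just y ∷ l) c
  ... | cy , cs = (xy , cy) , cs

  groups-chained l c = All-close (runs l) (λ _ → proj₁ (runs-chained l c)) (proj₂ (runs-chained l c))

  system⇒layout : ∀ 𝒫 → SystemOfCoordinatingPaths β 𝒫 → IsLayout (join 𝒫)
  system⇒layout 𝒫 (paths , cover) = record
    { unique   = subst (λ l → Unique (coords l)) (sym (catMaybes-join 𝒫))
                   (from (unique-concat 𝒫) ((λ a → proj₂ (proj₂ (paths a))) , λ i → proj₂ (cover i)))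
    ; complete = λ i → subst (λ l → i ∈ coords l) (sym (catMaybes-join 𝒫))
                   (to (meets-concat 𝒫 i) (proj₁ (cover i)))
    ; chained  = chained-join 𝒫 (λ a → proj₁ (proj₂ (paths a)))
    }

  layout⇒system : ∀ l → IsLayout l → SystemOfCoordinatingPaths β (groups l)
  layout⇒system l L =
    (λ a → all-at (groups-nonempty l) a , all-at (groups-chained l chained) a , proj₁ unique-parts a) ,
    (λ i → from (meets-concat (groups l) i) (subst (λ l′ → i ∈ coords l′) (sym (concat-groups l)) (complete i)) ,
           proj₂ unique-parts i)
    where
    open IsLayout L
    unique-parts : (∀ a → Unique (coords (List.lookup (groups l) a))) × MetAtMostOnce (groups l)
    unique-parts = to (unique-concat (groups l)) (subst (λ l′ → Unique (coords l′)) (sym (concat-groups l)) unique)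

embed-from-system : ∀ {n k} (G : FinGraph n) (β : Fin n → Vec Bool k) →
  IsometricEmbedding (toGraph G) (Q k) β → ∀ 𝒫 → SystemOfCoordinatingPaths β 𝒫 →
  Embeds (toGraph G) (Γ (k + length 𝒫 ∸ 1))
embed-from-system {n} {k} G β isβ 𝒫 system =
  subst (λ m → Embeds (toGraph G) (Γ m)) dimension (α , isometric-via-ham (Γ-hamming _) α same)
  where
  open PartialCubeFacts G β isβ
  open Layout β
  open SystemsAndLayouts β
  l : List (Maybe (Node k))
  l = join 𝒫
  L : IsLayout l
  L = system⇒layout 𝒫 system
  t : Vec (Maybe (Node k)) (length l)
  t = fromList l
  L′ : IsLayout (toList t)
  L′ = subst IsLayout (sym (toList∘fromList l)) L
  α : Fin n → FibString (length l)
  α u = image t u , chained⇒fib t (IsLayout.chained L′) u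
  same : ∀ u v → ham (image t u) (image t v) ≡ ham (β u) (β v)
  same = image-ham t (IsLayout.unique L′) (IsLayout.complete L′)
  dimension : length l ≡ k + length 𝒫 ∸ 1
  dimension = join-length k 𝒫 (layout-length L)

module LowerBound {n k m} (G : FinGraph n) (β : Fin n → Vec Bool k)
    (isβ : IsometricEmbedding (toGraph G) (Q k) β)
    (minimal : ∀ m′ → m′ < k → ¬ Embeds (toGraph G) (Q m′))
    (α : Fin n → FibString m) (isα : IsometricEmbedding (toGraph G) (Γ m) α) where

  open PartialCubeFacts G β isβ

  α′ : Fin n → Vec Bool m
  α′ u = proj₁ (α u)

  ham-α : ∀ u v → ham (α′ u) (α′ v) ≡ ham (β u) (β v)
  ham-α u v = to (dist-code (Γ-hamming m) (α u) (α v) _) (to (proj₂ isα u v _) (from (dist-β u v _) refl))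

  α-edge : ∀ {u v} → adj G u v → DifferInExactlyOne (α′ u) (α′ v)
  α-edge {u} {v} uv =
    ham≡1⇒differ {x = α′ u} {α′ v} (trans (ham-α u v) (differ⇒ham≡1 {x = β u} {β v} (edge-differ uv)))

  Represents : Fin m → Fin k → Bool → Set
  Represents j i χ = ∀ w → lookup (α′ w) j ≡ true ⇔ lookup (β w) i ≡ χ

  -- Across an edge uv cut by coordinate i of β and coordinate j of α, both
  -- coordinates split the vertices in the same way: by which end is closer.
  same-split : ∀ {u v} → adj G u v → ∀ {i j} → lookup (β u) i ≢ lookup (β v) i →
    lookup (α′ u) j ≢ lookup (α′ v) j →
    ∀ w → lookup (α′ w) j ≡ lookup (α′ u) j ⇔ lookup (β w) i ≡ lookup (β u) i
  same-split {u} {v} uv {i} {j} cut-β cut-α w =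
    ⇔-trans (closer-side {x = α′ u} {α′ v} (α-edge uv) cut-α (α′ w))
      (⇔-trans (subst-< (ham-α w u) (ham-α w v))
               (⇔-sym (closer-side {x = β u} {β v} (edge-differ uv) cut-β (β w))))
    where
    subst-< : ∀ {a b a′ b′} → a ≡ a′ → b ≡ b′ → (a < b) ⇔ (a′ < b′)
    subst-< refl refl = mk⇔ (λ p → p) (λ p → p)

  -- Every edge cut by coordinate i of β exhibits a coordinate of α
  -- representing a semicube of the pair of i: orient the edge so that its
  -- first end has a 1 in the α-coordinate where the ends differ.
  representative : ∀ {u v} → adj G u v → ∀ {i} → lookup (β u) i ≢ lookup (β v) i →
    Σ (Fin m) λ j → Σ Bool λ χ → Represents j i χ
  representative {u} {v} uv {i} cut-β with α-edge uv
  ... | j , cut-α , _ with lookup (α′ u) j Boolₚ.≟ true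
  ...   | yes uj≡1 = j , lookup (β u) i , λ w →
            subst (λ b → lookup (α′ w) j ≡ b ⇔ _) uj≡1 (same-split uv cut-β cut-α w)
  ...   | no  uj≢1 = j , lookup (β v) i , λ w →
            subst (λ b → lookup (α′ w) j ≡ b ⇔ _) (other-is-true uj≢1 cut-α)
              (same-split (adj-sym G uv) (λ e → cut-β (sym e)) (λ e → cut-α (sym e)) w)
    where
    other-is-true : ∀ {a b} → a ≢ true → a ≢ b → b ≡ true
    other-is-true {true}  a≢1 _   = ⊥-elim (a≢1 refl)
    other-is-true {false} {true}  _ _   = refl
    other-is-true {false} {false} _ a≢b = ⊥-elim (a≢b refl)

  -- A coordinate of α represents semicubes of at most one pair: an edge
  -- cut by coordinate i of β is cut by no other coordinate of β.
  represents-one-pair : ∀ {j i i′ χ χ′} → Represents j i χ → Represents j i′ χ′ →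
    ∀ {x y} → adj G x y → lookup (β x) i ≢ lookup (β y) i → i ≡ i′
  represents-one-pair {j} {i} {i′} {χ} {χ′} rep rep′ {x} {y} xy cut with i Finₚ.≟ i′
  ... | yes i≡i′ = i≡i′
  ... | no  i≢i′ = ⊥-elim (cut (same-bit
        (⇔-trans (⇔-sym (rep x)) (⇔-trans (rep′ x)
        (⇔-trans agree-i′ (⇔-trans (⇔-sym (rep′ y)) (rep y)))))))
    where
    agree-i′ : lookup (β x) i′ ≡ χ′ ⇔ lookup (β y) i′ ≡ χ′
    agree-i′ rewrite differ-elsewhere {x = β x} {β y} (edge-differ xy) cut i′ (λ e → i≢i′ (sym e)) =
      mk⇔ (λ e → e) (λ e → e)
    same-bit : ∀ {a b χ : Bool} → a ≡ χ ⇔ b ≡ χ → a ≡ b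
    same-bit {false} {false}         _ = refl
    same-bit {true}  {true}          _ = refl
    same-bit {false} {true}  {false} e = sym (to e refl)
    same-bit {false} {true}  {true}  e = from e refl
    same-bit {true}  {false} {false} e = from e refl
    same-bit {true}  {false} {true}  e = sym (to e refl)

  choice : ∀ i → Σ (Fin m) λ j → Σ Bool λ χ → Represents j i χ
  choice i with crossing-edge G β isβ minimal i
  ... | x , y , xy , cut = representative xy cut

  sel : Fin k → Fin m
  sel i = proj₁ (choice i)

  chi : Fin k → Bool
  chi i = proj₁ (proj₂ (choice i))

  sel-represents : ∀ i → Represents (sel i) i (chi i)
  sel-represents i = proj₂ (proj₂ (choice i))

  sel-injective : ∀ {i i′} → sel i ≡ sel i′ → i ≡ i′
  sel-injective {i} {i′} sel-i≡sel-i′ =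
    represents-one-pair (sel-represents i)
      (subst (λ j → Represents j i′ (chi i′)) (sym sel-i≡sel-i′) (sel-represents i′)) xy cut
    where
    edge : Σ (Fin n) λ x → Σ (Fin n) λ y → adj G x y × lookup (β x) i ≢ lookup (β y) i
    edge = crossing-edge G β isβ minimal i
    xy : adj G (proj₁ edge) (proj₁ (proj₂ edge))
    xy = proj₁ (proj₂ (proj₂ edge))
    cut : lookup (β (proj₁ edge)) i ≢ lookup (β (proj₁ (proj₂ edge))) i
    cut = proj₂ (proj₂ (proj₂ edge))

  slot : Fin m → Maybe (Node k)
  slot j with Finₚ.any? (λ i → sel i Finₚ.≟ j)
  ... | yes (i , _) = just (i , chi i)
  ... | no  _       = nothing

  slot-sound : ∀ j {i χ} → slot j ≡ just (i , χ) → sel i ≡ j × χ ≡ chi i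
  slot-sound j with Finₚ.any? (λ i → sel i Finₚ.≟ j)
  ... | yes (i , sel-i≡j) = λ { refl → sel-i≡j , refl }
  ... | no  _             = λ ()

  slot-sel : ∀ i → slot (sel i) ≡ just (i , chi i)
  slot-sel i with Finₚ.any? (λ i′ → sel i′ Finₚ.≟ sel i)
  ... | yes (i′ , sel-i′≡sel-i) with sel-injective sel-i′≡sel-i
  ...   | refl = refl
  slot-sel i | no none = ⊥-elim (none (i , refl))

  open Layout β
  open SystemsAndLayouts β

  t : Vec (Maybe (Node k)) m
  t = Vec.tabulate slot

  image-below : ∀ w → Below (image t w) (α′ w)
  image-below w j rewrite lookup-map j (bit w) t | lookup∘tabulate slot j = bit-below (slot j) refl
    where
    bit-below : ∀ s → slot j ≡ s → bit w s ≡ true → lookup (α′ w) j ≡ true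
    bit-below nothing        _  ()
    bit-below (just (i , χ)) eq bit≡1 with slot-sound j eq
    ... | refl , refl = from (sel-represents i w) (to (bit-true w (i , χ)) bit≡1)

  -- The layout t uses each pair exactly once and, lying below the
  -- Fibonacci strings of α, is chained.
  t-unique : Unique (indices (toList t))
  t-unique = tabulate-unique slot proj₁ λ j j′ e e′ same →
    trans (sym (proj₁ (slot-sound j e))) (trans (cong sel same) (proj₁ (slot-sound j′ e′)))

  t-layout : IsLayout (toList t)
  t-layout = record
    { unique   = t-unique
    ; complete = λ i → ∈-map⁺ proj₁ (tabulate-∈ slot (sel i) (slot-sel i))
    ; chained  = fib⇒chained t t-unique λ w →
                   IsFib-downward (image t w) (α′ w) (image-below w) (proj₂ (α w))
    }

  -- The runs of the layout form a system, so p ≤ blanks + 1 = m - k + 1.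
  bound : ∀ p → IsPX β p → k + p ∸ 1 ≤ m
  bound p (_ , least) = begin
    k + p ∸ 1              ≤⟨ ∸-monoˡ-≤ 1 (+-monoʳ-≤ k few-paths) ⟩
    k + suc (blanks l) ∸ 1 ≡⟨ cong (_∸ 1) (+-suc k (blanks l)) ⟩
    k + blanks l           ≡⟨ sym (layout-length t-layout) ⟩
    length l               ≡⟨ length-toList t ⟩
    m                      ∎
    where
    open ≤-Reasoning
    l : List (Maybe (Node k))
    l = toList t
    few-paths : p ≤ suc (blanks l)
    few-paths = ≤-trans (least (groups l) (layout⇒system l t-layout)) (length-groups l)

theorem3p3 : ∀ {n} (G : FinGraph n) → PartialCube G →
    ∀ (k : ℕ) → IsIdim G k →
    ∀ (β : Fin n → Vec Bool k) → IsometricEmbedding (toGraph G) (Q k) β →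
    ∀ (p : ℕ) → IsPX β p →
    IsFdim G (k + p ∸ 1)
theorem3p3 G _ k (_ , minimal) β isβ p pX@((𝒫 , system , |𝒫|≡p) , _) = upper , lower
  where
  upper : Embeds (toGraph G) (Γ (k + p ∸ 1))
  upper = subst (λ q → Embeds (toGraph G) (Γ (k + q ∸ 1))) |𝒫|≡p (embed-from-system G β isβ 𝒫 system)
  lower : ∀ m → m < k + p ∸ 1 → ¬ Embeds (toGraph G) (Γ m)
  lower m m<f (α , isα) = <⇒≱ m<f (LowerBound.bound G β isβ minimal α isα p pX)
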